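{- Let $p\in\mathrm{OFS}(\mathbb{Z}^+)$ and $d=\gcd(p)$. For each $i=1,\ldots,d$, the map $\gamma_i$ from the vertex set of $G_{p/d}$ to that of $G_p$ given by $\gamma_i(j)=i+(j-1)d$ for $1\le j\le fw(p/d)$ is an injective graph homomorphism which is an isomorphism from $G_{p/d}$ onto the subgraph of $G_p$ induced on its image $\gamma_i(G_{p/d})$. Moreover, $G_p$ has exactly $d$ connected components, namely the images of the $\gamma_i$, $i=1,\ldots,d$; that is, the congruence classes modulo $d$ of the interval $\{1,2,\ldots,fw(p)\}$.
   Context: $\mathrm{OFS}(\mathbb{Z}^+)$ denotes the set of all nonempty strictly increasing finite sequences of positive integers. For $p\in\mathrm{OFS}(\mathbb{Z}^+)$, $|p|$ is its length, $p_i$ its $i$-th entry, $p|_i=(p_1,\ldots,p_i)$, $\gcd(p)$ the gcd of its entries, $\max(p)=p_{|p|}$, and for $d=\gcd(p)$, $p/d=(p_1/d,\ldots,p_{|p|}/d)$. The map $R$: $R(p)=p$ if $|p|=1$; if $n=|p|>1$, form $(p_2-p_1,\ldots,p_n-p_1)$ and, if $p_1$ does not appear in it, insert $p_1$ so that the result is strictly increasing. $f$ is defined recursively by $f(p)=p_1$ if $|p|=1$ and $f(p)=p_1+f(R(p))$ if $|p|>1$. $fw$ is defined by: if $n=|p|>1$, $\gcd(p|_{n-1})=\gcd(p)$ and $\max(p)\ge f(p|_{n-1})$, then $fw(p)=fw(p|_{n-1})$; otherwise $fw(p)=f(p)$. For a positive integer $k$, $G(p,k)$ is the simple graph with vertex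 set $\{1,\ldots,k\}$ and edges $\{i,j\}$ with $|i-j|=p_t$ for some $t$. $G_p=G(p,fw(p))$. -}

module Defs where

open import Data.Nat using (ℕ; zero; suc; _+_; _*_; _∸_; _≤_; _<_; _≡ᵇ_; _<ᵇ_; _≤ᵇ_; ∣_-_∣)
open import Data.Nat.GCD using (gcd)
open import Data.Nat.DivMod using (_/_)
open import Data.Nat.Divisibility using (_∣_)
open import Data.Bool using (Bool; true; false; if_then_else_; _∧_)
open import Data.List using (List; []; _∷_; map; foldr; length)
open import Data.Bool.ListAction using (any)
open import Data.List.Membership.Propositional using (_∈_)
open import Data.List.Relation.Unary.All using (All)
open import Data.List.Relation.Unary.Linked using (Linked)
open import Data.Product using (_×_; Σ; ∃; _,_)
open import Relation.Binary.PropositionalEquality using (_≡_; _≢_)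

OFS : List ℕ → Set
OFS p = (p ≢ []) × All (1 ≤_) p × Linked _<_ p

gcdL : List ℕ → ℕ
gcdL = foldr gcd 0

-- max(p) = p_{|p|}, the last entry (0 for the empty list, junk)
lastℕ : List ℕ → ℕ
lastℕ []           = 0
lastℕ (x ∷ [])     = x
lastℕ (x ∷ y ∷ ys) = lastℕ (y ∷ ys)

dropLast : List ℕ → List ℕ
dropLast []           = []
dropLast (x ∷ [])     = []
dropLast (x ∷ y ∷ ys) = x ∷ dropLast (y ∷ ys)

-- division by d (d is gcd(p) ≥ 1 for p ∈ OFS; value for d = 0 is junk)
divBy : ℕ → ℕ → ℕ
divBy m zero    = 0
divBy m (suc d) = m / suc d

divGcd : List ℕ → List ℕ
divGcd p = map (λ x → divBy x (gcdL p)) p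

insertSorted : ℕ → List ℕ → List ℕ
insertSorted x []       = x ∷ []
insertSorted x (y ∷ ys) = if x <ᵇ y then x ∷ y ∷ ys else y ∷ insertSorted x ys

R : List ℕ → List ℕ
R []           = []
R (x ∷ [])     = x ∷ []
R (x ∷ y ∷ ys) =
  let zs = map (λ z → z ∸ x) (y ∷ ys)
  in if any (x ≡ᵇ_) zs then zs else insertSorted x zs

-- f with fuel. Since max(R(p)) < max(p) when |p| > 1 and entries are positive,
-- fuel max(p) always suffices, so fF (max p) p is the recursive f of the paper.
fF : ℕ → List ℕ → ℕ
fF zero    p            = 0
fF (suc k) []           = 0
fF (suc k) (x ∷ [])     = x
fF (suc k) (x ∷ y ∷ ys) = x + fF k (R (x ∷ y ∷ ys))

f : List ℕ → ℕ
f p = fF (lastℕ p) p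

-- fw with fuel; each recursive step drops one entry, so fuel |p| suffices.
fwF : ℕ → List ℕ → ℕ
fwF zero    p            = f p
fwF (suc k) []           = f []
fwF (suc k) (x ∷ [])     = f (x ∷ [])
fwF (suc k) (x ∷ y ∷ ys) =
  let p = x ∷ y ∷ ys ; q = dropLast p
  in if (gcdL q ≡ᵇ gcdL p) ∧ (f q ≤ᵇ lastℕ p) then fwF k q else f p

fw : List ℕ → ℕ
fw p = fwF (length p) p

Vertex : ℕ → ℕ → Set
Vertex k i = 1 ≤ i × i ≤ k

Adj : List ℕ → ℕ → ℕ → ℕ → Set
Adj p k i j = Vertex k i × Vertex k j × ∣ i - j ∣ ∈ p

data Connected (p : List ℕ) (k : ℕ) : ℕ → ℕ → Set where
  here : ∀ {u} → Vertex k u → Connected p k u u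
  step : ∀ {u w v} → Adj p k u w → Connected p k w v → Connected p k u v

γ : ℕ → ℕ → ℕ → ℕ
γ d i j = i + (j ∸ 1) * d

Cong : ℕ → ℕ → ℕ → Set
Cong d u v = d ∣ ∣ u - v ∣

module Submission where

-- The proof has two independent halves.
-- (1) Connectivity.  Every edge of G(p,k) joins vertices congruent modulo gcd(p), so
--     connected vertices are congruent.  Conversely, congruent vertices of G(p, f(p))
--     are connected, by induction along the recursion f(p) = x + f(R(p)) for
--     p = (x, y, …): an edge of length y′ − x in G(R(p), n) becomes the two-step path
--     a → a + y′ → a + y′ − x in G(p, x + n), a vertex above n is joined by an x-edge
--     to a vertex below it, and gcd(R(p)) divides gcd(p).  The property passes to
--     fw(p), which is either f(p) or fw of a prefix with the same gcd.
-- (2) Scaling.  Every operation defining f and fw commutes with multiplying all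
--     entries by c ≥ 1, so fw(c·q) = c·fw(q).  Hence {1, …, fw(c·q)} is the disjoint
--     union of the progressions γ_i({1, …, fw q}), i = 1, …, c, and γ_i multiplies
--     distances by c, so it maps G_q isomorphically onto the subgraph it spans.
-- The theorem is (2) for c = gcd(p) and q = p/d, combined with (1) for p = c·q.

open import Defs
open import Data.Bool using (Bool; true; false; T; if_then_else_; _∧_; _∨_)
open import Data.Bool.ListAction using (any)
open import Data.Empty using (⊥-elim)
open import Data.List using (List; []; _∷_; map; length)
open import Data.List.Properties using (length-map)
open import Data.List.Membership.Propositional using (_∈_; _∉_)
open import Data.List.Membership.Propositional.Properties using (∈-map⁺; ∈-map⁻)
open import Data.List.Relation.Unary.Any as Any using (here; there)
open import Data.List.Relation.Unary.Any.Properties using (any⁺; any⁻)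
open import Data.List.Relation.Unary.All as All using (All; []; _∷_; lookup)
open import Data.List.Relation.Unary.All.Properties using (anti-mono)
open import Data.List.Relation.Unary.Linked as Linked using (Linked; []; [-]; _∷_)
open import Data.List.Relation.Unary.Linked.Properties as Linkedₚ using (Linked⇒All)
open import Data.Nat
open import Data.Nat.Properties
open import Data.Nat.Divisibility
open import Data.Nat.DivMod
open import Data.Nat.GCD
open import Data.Product using (_×_; Σ; ∃; _,_; proj₁; proj₂)
open import Data.Sum using (_⊎_; inj₁; inj₂)
open import Data.Unit using (tt)
open import Function.Bundles using (_⇔_; mk⇔)
open import Relation.Binary.Definitions using (tri<; tri≈; tri>)
open import Relation.Binary.PropositionalEquality
open import Relation.Nullary using (yes; no)

cong-refl : ∀ d u → Cong d u u
cong-refl d u = subst (d ∣_) (sym (∣n-n∣≡0 u)) (d ∣0)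

cong-sym : ∀ d u v → Cong d u v → Cong d v u
cong-sym d u v = subst (d ∣_) (∣-∣-comm u v)

cong-shift : ∀ d u x → d ∣ x → Cong d (u + x) u
cong-shift d u x = subst (d ∣_) (sym (∣m+n-m∣≡n u x))
  where
  ∣m+n-m∣≡n : ∀ m n → ∣ m + n - m ∣ ≡ n
  ∣m+n-m∣≡n m n = trans (∣-∣-comm (m + n) m) (∣m-m+n∣≡n m n)

∣∸⇒%≡ : ∀ d {a b} .{{_ : NonZero d}} → a ≤ b → d ∣ b ∸ a → a % d ≡ b % d
∣∸⇒%≡ d {a} a≤b d∣b∸a = trans (sym (%-remove-+ʳ a d∣b∸a)) (cong (_% d) (m+[n∸m]≡n a≤b))

%≡⇒∣∸ : ∀ d {a b} .{{_ : NonZero d}} → a ≤ b → a % d ≡ b % d → d ∣ b ∸ a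
%≡⇒∣∸ d {a} {b} a≤b e = divides (b / d ∸ a / d) (begin
    b ∸ a                                     ≡⟨ cong₂ _∸_ (m≡m%n+[m/n]*n b d) (m≡m%n+[m/n]*n a d) ⟩
    (b % d + b / d * d) ∸ (a % d + a / d * d) ≡⟨ cong (λ r → (b % d + b / d * d) ∸ (r + a / d * d)) e ⟩
    (b % d + b / d * d) ∸ (b % d + a / d * d) ≡⟨ [m+n]∸[m+o]≡n∸o (b % d) _ _ ⟩
    b / d * d ∸ a / d * d                     ≡⟨ sym (*-distribʳ-∸ d (b / d) (a / d)) ⟩
    (b / d ∸ a / d) * d                       ∎)
  where open ≡-Reasoning

Cong⇒%≡ : ∀ d u v .{{_ : NonZero d}} → Cong d u v → u % d ≡ v % d
Cong⇒%≡ d u v c with ≤-total u v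
... | inj₁ u≤v = ∣∸⇒%≡ d u≤v (subst (d ∣_) (m≤n⇒∣m-n∣≡n∸m u≤v) c)
... | inj₂ v≤u = sym (∣∸⇒%≡ d v≤u (subst (d ∣_) (m≤n⇒∣m-n∣≡n∸m v≤u) (cong-sym d u v c)))

%≡⇒Cong : ∀ d u v .{{_ : NonZero d}} → u % d ≡ v % d → Cong d u v
%≡⇒Cong d u v e with ≤-total u v
... | inj₁ u≤v = subst (d ∣_) (sym (m≤n⇒∣m-n∣≡n∸m u≤v)) (%≡⇒∣∸ d u≤v e)
... | inj₂ v≤u = cong-sym d v u (subst (d ∣_) (sym (m≤n⇒∣m-n∣≡n∸m v≤u)) (%≡⇒∣∸ d v≤u (sym e)))

cong-trans : ∀ d u v w → Cong d u v → Cong d v w → Cong d u w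
cong-trans zero u v w c c′ = subst (λ z → Cong 0 z w) (sym (∣m-n∣≡0⇒m≡n {u} {v} (0∣⇒≡0 c))) c′
cong-trans d@(suc _) u v w c c′ = %≡⇒Cong d u w (trans (Cong⇒%≡ d u v c) (Cong⇒%≡ d v w c′))

block-vertices-≡ : ∀ {k u v} → Vertex k u → Vertex k v → Cong k u v → u ≡ v
block-vertices-≡ {k} {u} {v} vu vv c with ∣ u - v ∣ in eq
... | zero  = ∣m-n∣≡0⇒m≡n eq
... | suc t = ⊥-elim (>⇒∤ (subst (_< k) eq (distance< vu vv)) c)
  where
  distance< : ∀ {a b} → Vertex k a → Vertex k b → ∣ a - b ∣ < k
  distance< {a} {b} (1≤a , a≤k) (1≤b , b≤k) with ≤-total a b
  ... | inj₁ a≤b = subst (_< k) (sym (m≤n⇒∣m-n∣≡n∸m a≤b)) (<-≤-trans (∸-monoʳ-< 1≤a a≤b) b≤k)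
  ... | inj₂ b≤a = subst (_< k) (sym (trans (∣-∣-comm a b) (m≤n⇒∣m-n∣≡n∸m b≤a)))
                     (<-≤-trans (∸-monoʳ-< 1≤b b≤a) a≤k)

gcdL-∣ : ∀ {e} L → e ∈ L → gcdL L ∣ e
gcdL-∣ (x ∷ L) (here refl) = gcd[m,n]∣m x (gcdL L)
gcdL-∣ (x ∷ L) (there e∈L) = ∣-trans (gcd[m,n]∣n x (gcdL L)) (gcdL-∣ L e∈L)

gcdL-greatest : ∀ {g} L → (∀ {e} → e ∈ L → g ∣ e) → g ∣ gcdL L
gcdL-greatest [] _ = _ ∣0
gcdL-greatest (x ∷ L) g∣ = gcd-greatest (g∣ (here refl)) (gcdL-greatest L (λ e∈L → g∣ (there e∈L)))

gcdL-nonZero : ∀ {e} L → e ∈ L → NonZero e → NonZero (gcdL L)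
gcdL-nonZero {e} L e∈L e≢0 with gcdL L in eq
... | zero  = ⊥-elim (≢-nonZero⁻¹ e {{e≢0}} (0∣⇒≡0 (subst (_∣ e) eq (gcdL-∣ L e∈L))))
... | suc _ = _

last∈ : ∀ x L → lastℕ (x ∷ L) ∈ x ∷ L
last∈ x []      = here refl
last∈ x (y ∷ L) = there (last∈ y L)

head<tail : ∀ {x L} → Linked _<_ (x ∷ L) → All (x <_) L
head<tail {L = []} [-]       = []
head<tail (x<y ∷ l)        = Linked⇒All <-trans x<y l

≤last : ∀ {e} L → Linked _<_ L → e ∈ L → e ≤ lastℕ L
≤last (x ∷ [])    _       (here refl) = ≤-refl
≤last (x ∷ y ∷ L) l       (here refl) = <⇒≤ (lookup (head<tail l) (last∈ y L))
≤last (x ∷ y ∷ L) (_ ∷ l) (there e∈L) = ≤last (y ∷ L) l e∈L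

last-positive : ∀ L → OFS L → 1 ≤ lastℕ L
last-positive []      (L≢[] , _)  = ⊥-elim (L≢[] refl)
last-positive (x ∷ L) (_ , pos , _) = lookup pos (last∈ x L)

dropLast⊆ : ∀ {e} L → e ∈ dropLast L → e ∈ L
dropLast⊆ (x ∷ y ∷ L) (here refl) = here refl
dropLast⊆ (x ∷ y ∷ L) (there e∈L) = there (dropLast⊆ (y ∷ L) e∈L)

dropLast-linked : ∀ {r} {_~_ : ℕ → ℕ → Set r} L → Linked _~_ L → Linked _~_ (dropLast L)
dropLast-linked []              _         = []
dropLast-linked (x ∷ [])        _         = []
dropLast-linked (x ∷ y ∷ [])    _         = [-]
dropLast-linked (x ∷ y ∷ z ∷ L) (x~y ∷ l) = x~y ∷ dropLast-linked (y ∷ z ∷ L) l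

OFS-dropLast : ∀ x y L → OFS (x ∷ y ∷ L) → OFS (dropLast (x ∷ y ∷ L))
OFS-dropLast x y L (_ , pos , l) =
  (λ ()) , anti-mono (dropLast⊆ (x ∷ y ∷ L)) pos , dropLast-linked (x ∷ y ∷ L) l

any-≡ᵇ-true : ∀ x L → any (x ≡ᵇ_) L ≡ true → x ∈ L
any-≡ᵇ-true x L e = Any.map (≡ᵇ⇒≡ x _) (any⁻ (x ≡ᵇ_) L (subst T (sym e) tt))

any-≡ᵇ-false : ∀ x L → any (x ≡ᵇ_) L ≡ false → x ∉ L
any-≡ᵇ-false x L e x∈L = subst T e (any⁺ (x ≡ᵇ_) (Any.map (≡⇒≡ᵇ x _) x∈L))

insert∈ : ∀ {e} x L → e ∈ insertSorted x L → e ≡ x ⊎ e ∈ L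
insert∈ x [] (here refl) = inj₁ refl
insert∈ x (y ∷ L) e∈ with x <ᵇ y
insert∈ x (y ∷ L) (here refl) | true  = inj₁ refl
insert∈ x (y ∷ L) (there e∈L) | true  = inj₂ e∈L
insert∈ x (y ∷ L) (here refl) | false = inj₂ (here refl)
insert∈ x (y ∷ L) (there e∈)  | false with insert∈ x L e∈
... | inj₁ e≡x = inj₁ e≡x
... | inj₂ e∈L = inj₂ (there e∈L)

∈insert-new : ∀ x L → x ∈ insertSorted x L
∈insert-new x [] = here refl
∈insert-new x (y ∷ L) with x <ᵇ y
... | true  = here refl
... | false = there (∈insert-new x L)

∈insert-old : ∀ {e} x L → e ∈ L → e ∈ insertSorted x L
∈insert-old x (y ∷ L) e∈L with x <ᵇ y
... | true = there e∈L
∈insert-old x (y ∷ L) (here refl) | false = here refl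
∈insert-old x (y ∷ L) (there e∈L) | false = there (∈insert-old x L e∈L)

passed-below : ∀ {x y L} → x ∉ y ∷ L → (x <ᵇ y) ≡ false → y < x
passed-below {x} {y} x∉ e with <-cmp y x
... | tri< y<x _ _ = y<x
... | tri≈ _ refl _ = ⊥-elim (x∉ (here refl))
... | tri> _ _ x<y = ⊥-elim (subst T e (<⇒<ᵇ x<y))

insert-linked-below : ∀ a x L → a < x → x ∉ L → Linked _<_ (a ∷ L) → Linked _<_ (a ∷ insertSorted x L)
insert-linked-below a x [] a<x _ _ = a<x ∷ [-]
insert-linked-below a x (y ∷ L) a<x x∉ (a<y ∷ l) with x <ᵇ y in e
... | true  = a<x ∷ (<ᵇ⇒< x y (subst T (sym e) tt) ∷ l)
... | false = a<y ∷ insert-linked-below y x L (passed-below x∉ e) (λ x∈L → x∉ (there x∈L)) l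

insert-linked : ∀ x L → x ∉ L → Linked _<_ L → Linked _<_ (insertSorted x L)
insert-linked x [] _ _ = [-]
insert-linked x (y ∷ L) x∉ l with x <ᵇ y in e
... | true  = <ᵇ⇒< x y (subst T (sym e) tt) ∷ l
... | false = insert-linked-below y x L (passed-below x∉ e) (λ x∈L → x∉ (there x∈L)) l

R∈ : ∀ {e} x y ys → e ∈ R (x ∷ y ∷ ys) → e ≡ x ⊎ ∃ (λ y′ → y′ ∈ y ∷ ys × e ≡ y′ ∸ x)
R∈ x y ys e∈ with any (x ≡ᵇ_) (map (_∸ x) (y ∷ ys))
... | true = inj₂ (∈-map⁻ (_∸ x) e∈)
... | false with insert∈ x (map (_∸ x) (y ∷ ys)) e∈
...   | inj₁ e≡x = inj₁ e≡x
...   | inj₂ e∈  = inj₂ (∈-map⁻ (_∸ x) e∈)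

head∈R : ∀ x y ys → x ∈ R (x ∷ y ∷ ys)
head∈R x y ys with any (x ≡ᵇ_) (map (_∸ x) (y ∷ ys)) in e
... | true  = any-≡ᵇ-true x _ e
... | false = ∈insert-new x (map (_∸ x) (y ∷ ys))

difference∈R : ∀ {y′} x y ys → y′ ∈ y ∷ ys → y′ ∸ x ∈ R (x ∷ y ∷ ys)
difference∈R x y ys y′∈ with any (x ≡ᵇ_) (map (_∸ x) (y ∷ ys))
... | true  = ∈-map⁺ (_∸ x) y′∈
... | false = ∈insert-old x _ (∈-map⁺ (_∸ x) y′∈)

∸-linked : ∀ x y L → x < y → Linked _<_ (y ∷ L) → Linked _<_ (map (_∸ x) (y ∷ L))
∸-linked x y []      _   _         = [-]
∸-linked x y (z ∷ L) x<y (y<z ∷ l) = ∸-monoˡ-< y<z (<⇒≤ x<y) ∷ ∸-linked x z L (<-trans x<y y<z) l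

OFS-R : ∀ x y ys → OFS (x ∷ y ∷ ys) → OFS (R (x ∷ y ∷ ys))
OFS-R x y ys (_ , 1≤x ∷ _ , l@(x<y ∷ l′)) = R≢[] , All.tabulate positive , linked
  where
  R≢[] : R (x ∷ y ∷ ys) ≢ []
  R≢[] R≡[] with subst (x ∈_) R≡[] (head∈R x y ys)
  ... | ()
  positive : ∀ {e} → e ∈ R (x ∷ y ∷ ys) → 1 ≤ e
  positive e∈ with R∈ x y ys e∈
  ... | inj₁ refl               = 1≤x
  ... | inj₂ (y′ , y′∈ , refl) = m<n⇒0<n∸m (lookup (head<tail l) y′∈)
  linked : Linked _<_ (R (x ∷ y ∷ ys))
  linked with any (x ≡ᵇ_) (map (_∸ x) (y ∷ ys)) in e
  ... | true  = ∸-linked x y ys x<y l′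
  ... | false = insert-linked x _ (any-≡ᵇ-false x _ e) (∸-linked x y ys x<y l′)

R-entries< : ∀ x y ys → OFS (x ∷ y ∷ ys) → ∀ {e} → e ∈ R (x ∷ y ∷ ys) → e < lastℕ (y ∷ ys)
R-entries< x y ys (_ , 1≤x ∷ _ , l) e∈ with R∈ x y ys e∈
... | inj₁ refl = lookup (head<tail l) (last∈ y ys)
... | inj₂ (y′ , y′∈ , refl) =
  <-≤-trans (∸-monoʳ-< 1≤x (<⇒≤ (lookup (head<tail l) y′∈))) (≤last (y ∷ ys) (Linked.tail l) y′∈)

-- R strictly lowers the maximum; this bounds the recursion of f.
lastR< : ∀ x y ys → OFS (x ∷ y ∷ ys) → lastℕ (R (x ∷ y ∷ ys)) < lastℕ (y ∷ ys)
lastR< x y ys o with R (x ∷ y ∷ ys) | OFS-R x y ys o | R-entries< x y ys o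
... | []     | (R≢[] , _) | _        = ⊥-elim (R≢[] refl)
... | z ∷ zs | _          | entries< = entries< (last∈ z zs)

adj-sym : ∀ {p k u v} → Adj p k u v → Adj p k v u
adj-sym {p} {u = u} {v} (vu , vv , d∈p) = vv , vu , subst (_∈ p) (∣-∣-comm u v) d∈p

edge : ∀ {p k a b} → Vertex k a → Vertex k b → ∣ a - b ∣ ∈ p → Connected p k a b
edge va vb d∈p = step (va , vb , d∈p) (here vb)

conn-trans : ∀ {p k u v w} → Connected p k u v → Connected p k v w → Connected p k u w
conn-trans (here _)   c′ = c′
conn-trans (step a c) c′ = step a (conn-trans c c′)

conn-sym : ∀ {p k u v} → Connected p k u v → Connected p k v u
conn-sym (here vu)  = here vu
conn-sym (step a c) = conn-trans (conn-sym c) (edge (proj₁ (proj₂ a)) (proj₁ a) (proj₂ (proj₂ (adj-sym a))))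

conn-widen : ∀ {p p′ k u v} → (∀ {e} → e ∈ p → e ∈ p′) → Connected p k u v → Connected p′ k u v
conn-widen p⊆p′ (here vu)             = here vu
conn-widen p⊆p′ (step (vu , vw , e) c) = step (vu , vw , p⊆p′ e) (conn-widen p⊆p′ c)

-- Edge lengths are multiples of gcd(p), so connected vertices are congruent.
conn⇒cong : ∀ p k u v → Connected p k u v → Cong (gcdL p) u v
conn⇒cong p k u v (here _) = cong-refl (gcdL p) u
conn⇒cong p k u v (step {w = w} (_ , _ , e) c) =
  cong-trans (gcdL p) u w v (gcdL-∣ p e) (conn⇒cong p k w v c)

CongConnected : List ℕ → ℕ → Set
CongConnected p K = ∀ u v → Vertex K u → Vertex K v → Cong (gcdL p) u v → Connected p K u v

-- The inductive step: from G(R(p), n) to G(p, x + n) for p = (x, y, …) and x ≤ n.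
module ReductionStep (x y : ℕ) (ys : List ℕ) (o : OFS (x ∷ y ∷ ys)) (n : ℕ) (x≤n : x ≤ n) where

  p : List ℕ
  p = x ∷ y ∷ ys

  K : ℕ
  K = x + n

  lift : ∀ {a} → Vertex n a → Vertex K a
  lift (1≤a , a≤n) = 1≤a , ≤-trans a≤n (m≤n+m n x)

  middle≡ : ∀ {a w y′} → a ≤ w → x ≤ y′ → w ∸ a ≡ y′ ∸ x → a + y′ ≡ w + x
  middle≡ {a} {w} {y′} a≤w x≤y′ eq = begin
    a + y′             ≡⟨ cong (a +_) (sym (m∸n+n≡m x≤y′)) ⟩
    a + (y′ ∸ x + x)   ≡⟨ sym (+-assoc a _ x) ⟩
    a + (y′ ∸ x) + x   ≡⟨ cong (λ z → a + z + x) (sym eq) ⟩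
    a + (w ∸ a) + x    ≡⟨ cong (_+ x) (m+[n∸m]≡n a≤w) ⟩
    w + x              ∎
    where open ≡-Reasoning

  -- An edge of length y′ − x (y′ a later entry) is the path a → a + y′ → w.
  detour : ∀ {a w y′} → y′ ∈ y ∷ ys → Vertex n a → Vertex n w → a ≤ w → w ∸ a ≡ y′ ∸ x →
           Connected p K a w
  detour {a} {w} {y′} y′∈ va vw a≤w eq =
    step (lift va , vmid , subst (_∈ p) (sym (∣m-m+n∣≡n a y′)) (there y′∈))
         (edge vmid (lift vw) (subst (_∈ p) (sym x≡∣mid-w∣) (here refl)))
    where
    mid≡ : a + y′ ≡ w + x
    mid≡ = middle≡ a≤w (<⇒≤ (lookup (head<tail (proj₂ (proj₂ o))) y′∈)) eq
    vmid : Vertex K (a + y′)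
    vmid = ≤-trans (proj₁ va) (m≤m+n a y′) ,
           subst (_≤ K) (sym (trans mid≡ (+-comm w x))) (+-monoʳ-≤ x (proj₂ vw))
    x≡∣mid-w∣ : ∣ a + y′ - w ∣ ≡ x
    x≡∣mid-w∣ = trans (cong (λ z → ∣ z - w ∣) mid≡) (trans (∣-∣-comm (w + x) w) (∣m-m+n∣≡n w x))

  lift-edge : ∀ {a w} → Adj (R p) n a w → Connected p K a w
  lift-edge {a} {w} (va , vw , e) with R∈ x y ys e
  ... | inj₁ ∣a-w∣≡x = edge (lift va) (lift vw) (subst (_∈ p) (sym ∣a-w∣≡x) (here refl))
  ... | inj₂ (y′ , y′∈ , ∣a-w∣≡) with ≤-total a w
  ...   | inj₁ a≤w = detour y′∈ va vw a≤w (trans (sym (m≤n⇒∣m-n∣≡n∸m a≤w)) ∣a-w∣≡)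
  ...   | inj₂ w≤a = conn-sym (detour y′∈ vw va w≤a
                       (trans (sym (m≤n⇒∣m-n∣≡n∸m w≤a)) (trans (∣-∣-comm w a) ∣a-w∣≡)))

  lift-path : ∀ {a b} → Connected (R p) n a b → Connected p K a b
  lift-path (here va)  = here (lift va)
  lift-path (step e c) = conn-trans (lift-edge e) (lift-path c)

  lower : ∀ u → Vertex K u → ∃ λ u′ → Vertex n u′ × Connected p K u u′ × Cong (gcdL p) u u′
  lower u vu with u ≤? n
  ... | yes u≤n = u , (proj₁ vu , u≤n) , here vu , cong-refl (gcdL p) u
  ... | no u≰n  = u ∸ x , vu′ , edge vu (lift vu′) (subst (_∈ p) (sym ∣u-u′∣≡x) (here refl)) , u≡u′
    where
    x<u : x < u
    x<u = <-≤-trans (s≤s x≤n) (≰⇒> u≰n)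
    vu′ : Vertex n (u ∸ x)
    vu′ = m<n⇒0<n∸m x<u , m≤n+o⇒m∸n≤o u x (proj₂ vu)
    u≡ : u ∸ x + x ≡ u
    u≡ = m∸n+n≡m (<⇒≤ x<u)
    ∣u-u′∣≡x : ∣ u - u ∸ x ∣ ≡ x
    ∣u-u′∣≡x = subst (λ z → ∣ z - u ∸ x ∣ ≡ x) u≡ (trans (∣-∣-comm (u ∸ x + x) (u ∸ x)) (∣m-m+n∣≡n (u ∸ x) x))
    u≡u′ : Cong (gcdL p) u (u ∸ x)
    u≡u′ = subst (λ z → Cong (gcdL p) z (u ∸ x)) u≡ (cong-shift (gcdL p) (u ∸ x) x (gcdL-∣ p (here refl)))

  -- gcd(R(p)) divides x and every y′ − x, hence every entry of p.
  gcdR∣gcd : gcdL (R p) ∣ gcdL p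
  gcdR∣gcd = gcdL-greatest p divides-entry
    where
    divides-entry : ∀ {e} → e ∈ p → gcdL (R p) ∣ e
    divides-entry (here refl) = gcdL-∣ (R p) (head∈R x y ys)
    divides-entry (there e∈)  =
      subst (gcdL (R p) ∣_) (m∸n+n≡m (<⇒≤ (lookup (head<tail (proj₂ (proj₂ o))) e∈)))
        (∣m∣n⇒∣m+n (gcdL-∣ (R p) (difference∈R x y ys e∈)) (gcdL-∣ (R p) (head∈R x y ys)))

  congConnected : CongConnected (R p) n → CongConnected p K
  congConnected connR u v vu vv u≡v with lower u vu | lower v vv
  ... | u′ , vu′ , u~u′ , u≡u′ | v′ , vv′ , v~v′ , v≡v′ =
    conn-trans u~u′ (conn-trans (lift-path (connR u′ v′ vu′ vv′ u′≡v′)) (conn-sym v~v′))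
    where
    d : ℕ
    d = gcdL p
    u′≡v′ : Cong (gcdL (R p)) u′ v′
    u′≡v′ = ∣-trans gcdR∣gcd
      (cong-trans d u′ u v′ (cong-sym d u u′ u≡u′) (cong-trans d u v v′ u≡v v≡v′))

-- G(x) is the graph with the single edge length x on {1, …, x}: it has no edges,
-- and gcd(x) = x, so congruent vertices are equal.
singleton-congConnected : ∀ x → CongConnected (x ∷ []) x
singleton-congConnected x u v vu vv u≡v
  with block-vertices-≡ vu vv (subst (λ g → Cong g u v) (gcd-identityʳ x) u≡v)
... | refl = here vu

-- With enough fuel (k ≥ max p), fF k p is the paper's f(p): G(p, f p) has the
-- property, and f(p) ≥ max(p), which is what makes the next step's x ≤ n hold.
fF-congConnected : ∀ k p → OFS p → lastℕ p ≤ k → CongConnected p (fF k p) × lastℕ p ≤ fF k p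
fF-congConnected zero    p o max≤0 = ⊥-elim (<⇒≱ (last-positive p o) max≤0)
fF-congConnected (suc k) [] (p≢[] , _) _ = ⊥-elim (p≢[] refl)
fF-congConnected (suc k) (x ∷ []) o _ = singleton-congConnected x , ≤-refl
fF-congConnected (suc k) (x ∷ y ∷ ys) o max≤ =
  ReductionStep.congConnected x y ys o n x≤n connR , max≤x+n
  where
  oR : OFS (R (x ∷ y ∷ ys))
  oR = OFS-R x y ys o
  n : ℕ
  n = fF k (R (x ∷ y ∷ ys))
  IH : CongConnected (R (x ∷ y ∷ ys)) n × lastℕ (R (x ∷ y ∷ ys)) ≤ n
  IH = fF-congConnected k (R (x ∷ y ∷ ys)) oR (s≤s⁻¹ (≤-trans (lastR< x y ys o) max≤))
  connR : CongConnected (R (x ∷ y ∷ ys)) n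
  connR = proj₁ IH
  ≤n : ∀ {e} → e ∈ R (x ∷ y ∷ ys) → e ≤ n
  ≤n e∈ = ≤-trans (≤last _ (proj₂ (proj₂ oR)) e∈) (proj₂ IH)
  x≤n : x ≤ n
  x≤n = ≤n (head∈R x y ys)
  -- max p = x + (max p − x) and max p − x ∈ R p
  max≤x+n : lastℕ (y ∷ ys) ≤ x + n
  max≤x+n = subst (_≤ x + n) (m+[n∸m]≡n (<⇒≤ (lookup (head<tail (proj₂ (proj₂ o))) (last∈ y ys))))
              (+-monoʳ-≤ x (≤n (difference∈R x y ys (last∈ y ys))))

f-congConnected : ∀ p → OFS p → CongConnected p (f p) × 1 ≤ f p
f-congConnected p o with fF-congConnected (lastℕ p) p o ≤-refl
... | conn , max≤f = conn , ≤-trans (last-positive p o) max≤f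

-- Congruent vertices of G_p are connected: fw(p) is f(p), or fw of the prefix p|_{n-1}, which has
-- the same gcd and whose entries are entries of p.
fwF-congConnected : ∀ k p → OFS p → CongConnected p (fwF k p) × 1 ≤ fwF k p
fwF-congConnected zero    p o = f-congConnected p o
fwF-congConnected (suc k) [] (p≢[] , _) = ⊥-elim (p≢[] refl)
fwF-congConnected (suc k) (x ∷ []) o = f-congConnected _ o
fwF-congConnected (suc k) (x ∷ y ∷ ys) o
  with gcdL (dropLast (x ∷ y ∷ ys)) ≡ᵇ gcdL (x ∷ y ∷ ys) in same-gcd
... | false = f-congConnected _ o
... | true with f (dropLast (x ∷ y ∷ ys)) ≤ᵇ lastℕ (x ∷ y ∷ ys)
...   | false = f-congConnected _ o
...   | true with fwF-congConnected k (dropLast (x ∷ y ∷ ys)) (OFS-dropLast x y ys o)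
...     | connPrefix , positive = conn , positive
  where
  gcd≡ : gcdL (dropLast (x ∷ y ∷ ys)) ≡ gcdL (x ∷ y ∷ ys)
  gcd≡ = ≡ᵇ⇒≡ _ _ (subst T (sym same-gcd) tt)
  conn : CongConnected (x ∷ y ∷ ys) (fwF k (dropLast (x ∷ y ∷ ys)))
  conn u v vu vv u≡v = conn-widen (dropLast⊆ (x ∷ y ∷ ys))
    (connPrefix u v vu vv (subst (λ g → Cong g u v) (sym gcd≡) u≡v))

fw-congConnected : ∀ p → OFS p → CongConnected p (fw p) × 1 ≤ fw p
fw-congConnected p = fwF-congConnected (length p) p

fF-fuel : ∀ k k′ p → OFS p → lastℕ p ≤ k → lastℕ p ≤ k′ → fF k p ≡ fF k′ p
fF-fuel zero    _        p o max≤0 _     = ⊥-elim (<⇒≱ (last-positive p o) max≤0)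
fF-fuel (suc k) zero     p o _     max≤0 = ⊥-elim (<⇒≱ (last-positive p o) max≤0)
fF-fuel (suc k) (suc k′) [] (p≢[] , _) _ _ = ⊥-elim (p≢[] refl)
fF-fuel (suc k) (suc k′) (x ∷ []) o _ _ = refl
fF-fuel (suc k) (suc k′) (x ∷ y ∷ ys) o max≤ max≤′ = cong (x +_)
  (fF-fuel k k′ _ (OFS-R x y ys o) (s≤s⁻¹ (≤-trans (lastR< x y ys o) max≤))
                                   (s≤s⁻¹ (≤-trans (lastR< x y ys o) max≤′)))

T-ext : ∀ {a b : Bool} → (T a → T b) → (T b → T a) → a ≡ b
T-ext {false} {false} _ _ = refl
T-ext {false} {true}  _ g = ⊥-elim (g tt)
T-ext {true}  {false} f _ = ⊥-elim (f tt)
T-ext {true}  {true}  _ _ = refl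

module Scaling (c : ℕ) .{{c≢0 : NonZero c}} where

  scale : List ℕ → List ℕ
  scale = map (c *_)

  ≡ᵇ-scale : ∀ a b → (c * a ≡ᵇ c * b) ≡ (a ≡ᵇ b)
  ≡ᵇ-scale a b = T-ext (λ t → ≡⇒≡ᵇ a b (*-cancelˡ-≡ a b c (≡ᵇ⇒≡ _ _ t)))
                       (λ t → ≡⇒≡ᵇ _ _ (cong (c *_) (≡ᵇ⇒≡ a b t)))

  <ᵇ-scale : ∀ a b → (c * a <ᵇ c * b) ≡ (a <ᵇ b)
  <ᵇ-scale a b = T-ext (λ t → <⇒<ᵇ (*-cancelˡ-< c a b (<ᵇ⇒< _ _ t)))
                       (λ t → <⇒<ᵇ (*-monoʳ-< c (<ᵇ⇒< a b t)))

  ≤ᵇ-scale : ∀ a b → (c * a ≤ᵇ c * b) ≡ (a ≤ᵇ b)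
  ≤ᵇ-scale a b = T-ext (λ t → ≤⇒≤ᵇ (*-cancelˡ-≤ c (≤ᵇ⇒≤ (c * a) (c * b) t)))
                       (λ t → ≤⇒≤ᵇ (*-monoʳ-≤ c (≤ᵇ⇒≤ a b t)))

  last-scale : ∀ L → lastℕ (scale L) ≡ c * lastℕ L
  last-scale []          = sym (*-zeroʳ c)
  last-scale (x ∷ [])    = refl
  last-scale (x ∷ y ∷ L) = last-scale (y ∷ L)

  dropLast-scale : ∀ L → dropLast (scale L) ≡ scale (dropLast L)
  dropLast-scale []          = refl
  dropLast-scale (x ∷ [])    = refl
  dropLast-scale (x ∷ y ∷ L) = cong (c * x ∷_) (dropLast-scale (y ∷ L))

  gcd-scale : ∀ L → gcdL (scale L) ≡ c * gcdL L
  gcd-scale []      = sym (*-zeroʳ c)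
  gcd-scale (x ∷ L) = trans (cong (gcd (c * x)) (gcd-scale L)) (sym (c*gcd[m,n]≡gcd[cm,cn] c x (gcdL L)))

  insert-scale : ∀ x L → insertSorted (c * x) (scale L) ≡ scale (insertSorted x L)
  insert-scale x []      = refl
  insert-scale x (y ∷ L) rewrite <ᵇ-scale x y with x <ᵇ y
  ... | true  = refl
  ... | false = cong (c * y ∷_) (insert-scale x L)

  differences-scale : ∀ x L → map (_∸ c * x) (scale L) ≡ scale (map (_∸ x) L)
  differences-scale x []      = refl
  differences-scale x (z ∷ L) = cong₂ _∷_ (sym (*-distribˡ-∸ c z x)) (differences-scale x L)

  any-scale : ∀ x L → any (c * x ≡ᵇ_) (scale L) ≡ any (x ≡ᵇ_) L
  any-scale x []      = refl
  any-scale x (z ∷ L) = cong₂ _∨_ (≡ᵇ-scale x z) (any-scale x L)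

  R-scale : ∀ L → R (scale L) ≡ scale (R L)
  R-scale []           = refl
  R-scale (x ∷ [])     = refl
  R-scale (x ∷ y ∷ ys) = begin
    R (scale (x ∷ y ∷ ys))
      ≡⟨ cong (λ L → if any (c * x ≡ᵇ_) L then L else insertSorted (c * x) L) (differences-scale x (y ∷ ys)) ⟩
    (if any (c * x ≡ᵇ_) (scale zs) then scale zs else insertSorted (c * x) (scale zs))
      ≡⟨ cong (λ b → if b then scale zs else insertSorted (c * x) (scale zs)) (any-scale x zs) ⟩
    (if any (x ≡ᵇ_) zs then scale zs else insertSorted (c * x) (scale zs))
      ≡⟨ scale-branch (any (x ≡ᵇ_) zs) ⟩
    scale (R (x ∷ y ∷ ys))
      ∎
    where
    open ≡-Reasoning
    zs : List ℕ
    zs = map (_∸ x) (y ∷ ys)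
    scale-branch : ∀ b → (if b then scale zs else insertSorted (c * x) (scale zs))
                       ≡ scale (if b then zs else insertSorted x zs)
    scale-branch true  = refl
    scale-branch false = insert-scale x zs

  fF-scale : ∀ k L → fF k (scale L) ≡ c * fF k L
  fF-scale zero    L            = sym (*-zeroʳ c)
  fF-scale (suc k) []           = sym (*-zeroʳ c)
  fF-scale (suc k) (x ∷ [])     = refl
  fF-scale (suc k) (x ∷ y ∷ ys) = begin
    c * x + fF k (R (scale (x ∷ y ∷ ys))) ≡⟨ cong (λ L → c * x + fF k L) (R-scale (x ∷ y ∷ ys)) ⟩
    c * x + fF k (scale (R (x ∷ y ∷ ys))) ≡⟨ cong (c * x +_) (fF-scale k _) ⟩
    c * x + c * fF k (R (x ∷ y ∷ ys))     ≡⟨ sym (*-distribˡ-+ c x _) ⟩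
    c * (x + fF k (R (x ∷ y ∷ ys)))       ∎
    where open ≡-Reasoning

  -- f(c·L) = c·f(L); the fuel c·max L used on the left is enough for L as well.
  f-scale : ∀ L → OFS L → f (scale L) ≡ c * f L
  f-scale L o = begin
    fF (lastℕ (scale L)) (scale L) ≡⟨ cong (λ k → fF k (scale L)) (last-scale L) ⟩
    fF (c * lastℕ L) (scale L)     ≡⟨ fF-scale (c * lastℕ L) L ⟩
    c * fF (c * lastℕ L) L         ≡⟨ cong (c *_) (fF-fuel _ _ L o (m≤n*m (lastℕ L) c) ≤-refl) ⟩
    c * fF (lastℕ L) L             ∎
    where open ≡-Reasoning

  fwF-scale : ∀ k L → OFS L → fwF k (scale L) ≡ c * fwF k L
  fwF-scale zero    L o = f-scale L o
  fwF-scale (suc k) [] (L≢[] , _) = ⊥-elim (L≢[] refl)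
  fwF-scale (suc k) (x ∷ []) o = f-scale _ o
  fwF-scale (suc k) (x ∷ y ∷ ys) o = begin
    fwF (suc k) (scale L)
      ≡⟨ cong₂ (λ a b → if a ∧ b then fwF k (dropLast (scale L)) else f (scale L)) same-gcd≡ bound≡ ⟩
    (if same-gcd ∧ bound then fwF k (dropLast (scale L)) else f (scale L))
      ≡⟨ scale-branch (same-gcd ∧ bound) ⟩
    c * fwF (suc k) L
      ∎
    where
    open ≡-Reasoning
    L : List ℕ
    L = x ∷ y ∷ ys
    same-gcd bound : Bool
    same-gcd = gcdL (dropLast L) ≡ᵇ gcdL L
    bound    = f (dropLast L) ≤ᵇ lastℕ L
    same-gcd≡ : (gcdL (dropLast (scale L)) ≡ᵇ gcdL (scale L)) ≡ same-gcd
    same-gcd≡ = trans (cong₂ _≡ᵇ_ (trans (cong gcdL (dropLast-scale L)) (gcd-scale (dropLast L))) (gcd-scale L))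
                      (≡ᵇ-scale (gcdL (dropLast L)) (gcdL L))
    bound≡ : (f (dropLast (scale L)) ≤ᵇ lastℕ (scale L)) ≡ bound
    bound≡ = trans (cong₂ _≤ᵇ_ (trans (cong f (dropLast-scale L)) (f-scale _ (OFS-dropLast x y ys o))) (last-scale L))
                   (≤ᵇ-scale (f (dropLast L)) (lastℕ L))
    scale-branch : ∀ b → (if b then fwF k (dropLast (scale L)) else f (scale L))
                       ≡ c * (if b then fwF k (dropLast L) else f L)
    scale-branch true  = trans (cong (fwF k) (dropLast-scale L)) (fwF-scale k _ (OFS-dropLast x y ys o))
    scale-branch false = f-scale L o

  -- fw(c·L) = c·fw(L): the two conditions tested by fw are invariant under scaling.
  fw-scale : ∀ L → OFS L → fw (scale L) ≡ c * fw L
  fw-scale L o = trans (cong (λ k → fwF k (scale L)) (length-map (c *_) L)) (fwF-scale (length L) L o)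

  OFS-scale : ∀ L → OFS L → OFS (scale L)
  OFS-scale [] (L≢[] , _) = ⊥-elim (L≢[] refl)
  OFS-scale (x ∷ L) (_ , pos , l) = (λ ()) , scale-positive pos , Linkedₚ.map⁺ (Linked.map (*-monoʳ-< c) l)
    where
    scale-positive : ∀ {L} → All (1 ≤_) L → All (1 ≤_) (scale L)
    scale-positive []         = []
    scale-positive (1≤a ∷ as) = ≤-trans 1≤a (m≤n*m _ c) ∷ scale-positive as

  OFS-unscale : ∀ L → OFS (scale L) → OFS L
  OFS-unscale [] (L≢[] , _) = ⊥-elim (L≢[] refl)
  OFS-unscale (x ∷ L) (_ , pos , l) =
    (λ ()) , unscale-positive pos , Linked.map (*-cancelˡ-< c _ _) (Linkedₚ.map⁻ l)
    where
    unscale-positive : ∀ {L} → All (1 ≤_) (scale L) → All (1 ≤_) L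
    unscale-positive {[]}    []          = []
    unscale-positive {a ∷ _} (1≤ca ∷ as) = n≢0⇒n>0 (λ { refl → <⇒≱ 1≤ca (≤-reflexive (*-zeroʳ c)) }) ∷ unscale-positive as

  ∈-unscale : ∀ {e} L → c * e ∈ scale L → e ∈ L
  ∈-unscale {e} L ce∈ with ∈-map⁻ (c *_) ce∈
  ... | e′ , e′∈ , ce≡ce′ = subst (_∈ L) (sym (*-cancelˡ-≡ e e′ c ce≡ce′)) e′∈

γ-vertex : ∀ c i m j → 1 ≤ i → i ≤ c → Vertex m j → Vertex (c * m) (γ c i j)
γ-vertex c i m (suc j) 1≤i i≤c (_ , j<m) = ≤-trans 1≤i (m≤m+n i (j * c)) , (begin
  i + j * c ≤⟨ +-monoˡ-≤ (j * c) i≤c ⟩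
  suc j * c ≤⟨ *-monoˡ-≤ c j<m ⟩
  m * c     ≡⟨ *-comm m c ⟩
  c * m     ∎)
  where open ≤-Reasoning

γ-injective : ∀ c i {j j′} .{{_ : NonZero c}} → 1 ≤ j → 1 ≤ j′ → γ c i j ≡ γ c i j′ → j ≡ j′
γ-injective c i {suc j} {suc j′} _ _ eq = cong suc (*-cancelʳ-≡ j j′ c (+-cancelˡ-≡ i _ _ eq))

γ-distance : ∀ c i {j j′} → 1 ≤ j → 1 ≤ j′ → ∣ γ c i j - γ c i j′ ∣ ≡ c * ∣ j - j′ ∣
γ-distance c i {suc j} {suc j′} _ _ = begin
  ∣ i + j * c - i + j′ * c ∣ ≡⟨ ∣m+n-m+o∣≡∣n-o∣ i (j * c) (j′ * c) ⟩
  ∣ j * c - j′ * c ∣         ≡⟨ sym (*-distribʳ-∣-∣ c j j′) ⟩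
  ∣ j - j′ ∣ * c             ≡⟨ *-comm _ c ⟩
  c * ∣ j - j′ ∣             ∎
  where open ≡-Reasoning

γ-adjacency : ∀ c i m q .{{_ : NonZero c}} → 1 ≤ i → i ≤ c → ∀ j j′ → Vertex m j → Vertex m j′ →
              Adj q m j j′ ⇔ Adj (Scaling.scale c q) (c * m) (γ c i j) (γ c i j′)
γ-adjacency c i m q 1≤i i≤c j j′ vj vj′ = mk⇔
  (λ (_ , _ , d∈q) → γ-vertex c i m j 1≤i i≤c vj , γ-vertex c i m j′ 1≤i i≤c vj′ ,
                      subst (_∈ scale q) (sym distance≡) (∈-map⁺ (c *_) d∈q))
  (λ (_ , _ , d∈cq) → vj , vj′ , ∈-unscale q (subst (_∈ scale q) distance≡ d∈cq))
  where
  open Scaling c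
  distance≡ : ∣ γ c i j - γ c i j′ ∣ ≡ c * ∣ j - j′ ∣
  distance≡ = γ-distance c i (proj₁ vj) (proj₁ vj′)

γ-image : ∀ c i m u .{{_ : NonZero c}} → 1 ≤ i → i ≤ c → 1 ≤ m → Vertex (c * m) u →
          (∃ λ j → Vertex m j × γ c i j ≡ u) ⇔ Cong c u i
γ-image c i m u 1≤i i≤c 1≤m (1≤u , u≤cm) = mk⇔ image⇒class class⇒image
  where
  image⇒class : (∃ λ j → Vertex m j × γ c i j ≡ u) → Cong c u i
  image⇒class (suc j , _ , refl) = cong-shift c i (j * c) (n∣m*n j)
  class⇒image : Cong c u i → ∃ λ j → Vertex m j × γ c i j ≡ u
  class⇒image u≡i with ≤-total i u
  -- u ≤ i: both lie in {1, …, c}, so u = i = γ_i(1)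
  ... | inj₂ u≤i = 1 , (≤-refl , 1≤m) ,
        trans (+-identityʳ i) (sym (block-vertices-≡ (1≤u , ≤-trans u≤i i≤c) (1≤i , i≤c) u≡i))
  -- i ≤ u: u − i = t·c, so u = γ_i(t + 1), and t < m because u ≤ c·m
  ... | inj₁ i≤u with subst (c ∣_) (m≤n⇒∣m-n∣≡n∸m i≤u) (cong-sym c u i u≡i)
  ...   | divides t u∸i≡t*c = suc t , (s≤s z≤n , t<m) , u≡
    where
    u≡ : i + t * c ≡ u
    u≡ = trans (cong (i +_) (sym u∸i≡t*c)) (m+[n∸m]≡n i≤u)
    t<m : t < m
    t<m = *-cancelʳ-< c t m (begin-strict
      t * c     <⟨ m<n+m (t * c) 1≤i ⟩
      i + t * c ≡⟨ u≡ ⟩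
      u         ≤⟨ u≤cm ⟩
      c * m     ≡⟨ *-comm c m ⟩
      m * c     ∎)
      where open ≤-Reasoning

-- The assertion of Proposition 24 for p with reduced list q, d = gcd(p), N = fw(p)
-- and m = fw(q).
Proposition24 : List ℕ → List ℕ → ℕ → ℕ → ℕ → Set
Proposition24 p q d N m =
    ((i : ℕ) → 1 ≤ i → i ≤ d →
        ((j : ℕ) → Vertex m j → Vertex N (γ d i j))
      × ((j j′ : ℕ) → Vertex m j → Vertex m j′ → γ d i j ≡ γ d i j′ → j ≡ j′)
      × ((j j′ : ℕ) → Vertex m j → Vertex m j′ → Adj q m j j′ ⇔ Adj p N (γ d i j) (γ d i j′))
      × Vertex N i
      × ((u : ℕ) → Vertex N u → (Σ ℕ (λ j → Vertex m j × γ d i j ≡ u)) ⇔ Cong d u i))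
    × ((u v : ℕ) → Vertex N u → Vertex N v → Connected p N u v ⇔ Cong d u v)

scaled-proposition : ∀ c .{{_ : NonZero c}} q → OFS q → gcdL q ≡ 1 →
                     Proposition24 (Scaling.scale c q) q c (fw (Scaling.scale c q)) (fw q)
scaled-proposition c q oq gcd≡1 rewrite Scaling.fw-scale c q oq =
  (λ i 1≤i i≤c →
       (λ j → γ-vertex c i (fw q) j 1≤i i≤c)
     , (λ j j′ vj vj′ → γ-injective c i (proj₁ vj) (proj₁ vj′))
     , γ-adjacency c i (fw q) q 1≤i i≤c
     , (1≤i , ≤-trans i≤c (m≤m*n c (fw q) {{>-nonZero 1≤fw}}))
     , (λ u → γ-image c i (fw q) u 1≤i i≤c 1≤fw))
  , λ u v vu vv → mk⇔
      (λ u~v → subst (λ g → Cong g u v) gcd≡c (conn⇒cong (scale q) _ u v u~v))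
      (λ u≡v → connected u v vu vv (subst (λ g → Cong g u v) (sym gcd≡c) u≡v))
  where
  open Scaling c
  1≤fw : 1 ≤ fw q
  1≤fw = proj₂ (fw-congConnected q oq)
  gcd≡c : gcdL (scale q) ≡ c
  gcd≡c = trans (gcd-scale q) (trans (cong (c *_) gcd≡1) (*-identityʳ c))
  connected : CongConnected (scale q) (c * fw q)
  connected = subst (CongConnected (scale q)) (fw-scale q oq)
                (proj₁ (fw-congConnected (scale q) (OFS-scale q oq)))

gcd-nonZero : ∀ p → OFS p → NonZero (gcdL p)
gcd-nonZero []      (p≢[] , _)     = ⊥-elim (p≢[] refl)
gcd-nonZero (x ∷ p) (_ , 1≤x ∷ _ , _) = gcdL-nonZero (x ∷ p) (here refl) (>-nonZero 1≤x)

scale-divBy : ∀ d .{{_ : NonZero d}} L → (∀ {e} → e ∈ L → d ∣ e) →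
              Scaling.scale d (map (λ x → divBy x d) L) ≡ L
scale-divBy d         []      _  = refl
scale-divBy d@(suc _) (x ∷ L) d∣ = cong₂ _∷_ (m*[n/m]≡n (d∣ (here refl))) (scale-divBy d L (λ e∈ → d∣ (there e∈)))

proposition24 : (p : List ℕ) → OFS p →
    ((i : ℕ) → 1 ≤ i → i ≤ gcdL p →
        ((j : ℕ) → Vertex (fw (divGcd p)) j → Vertex (fw p) (γ (gcdL p) i j))
      × ((j j′ : ℕ) → Vertex (fw (divGcd p)) j → Vertex (fw (divGcd p)) j′ → γ (gcdL p) i j ≡ γ (gcdL p) i j′ → j ≡ j′)
      × ((j j′ : ℕ) → Vertex (fw (divGcd p)) j → Vertex (fw (divGcd p)) j′ → Adj (divGcd p) (fw (divGcd p)) j j′ ⇔ Adj p (fw p) (γ (gcdL p) i j) (γ (gcdL p) i j′))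
      × Vertex (fw p) i
      × ((u : ℕ) → Vertex (fw p) u → (Σ ℕ (λ j → Vertex (fw (divGcd p)) j × γ (gcdL p) i j ≡ u)) ⇔ Cong (gcdL p) u i))
    × ((u v : ℕ) → Vertex (fw p) u → Vertex (fw p) v → Connected p (fw p) u v ⇔ Cong (gcdL p) u v)
proposition24 p o =
  subst (λ p′ → Proposition24 p′ q d (fw p′) (fw q)) p≡dq (scaled-proposition d q oq gcd-q≡1)
  where
  d : ℕ
  d = gcdL p
  q : List ℕ
  q = divGcd p
  instance
    d≢0 : NonZero d
    d≢0 = gcd-nonZero p o
  open Scaling d
  p≡dq : scale q ≡ p
  p≡dq = scale-divBy d p (gcdL-∣ p)
  oq : OFS q
  oq = OFS-unscale q (subst OFS (sym p≡dq) o)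
  -- d · gcd(p/d) = gcd(p) = d · 1
  gcd-q≡1 : gcdL q ≡ 1
  gcd-q≡1 = *-cancelˡ-≡ (gcdL q) 1 d (trans (sym (gcd-scale q)) (trans (cong gcdL p≡dq) (sym (*-identityʳ d))))
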